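{- Assume the set $\mathcal P$ of atoms is finite. Let $\mathcal C$ be a class of state-pointed in-models. Then $\mathcal C$ is definable in $\mathsf{InqML}_{\Rrightarrow}$, i.e. there is a formula $\varphi\in\mathcal L_{\Rrightarrow}$ with $\mathcal C=\{\langle M,s\rangle : M,s\models\varphi\}$, if and only if (i) there is some $n\in\mathbb N$ such that $\mathcal C$ is closed under $n$-bisimilarity (i.e. $\langle M,s\rangle\in\mathcal C$ and $M,s\sim_n M',s'$ imply $\langle M',s'\rangle\in\mathcal C$), (ii) $\mathcal C$ is non-empty, and (iii) $\mathcal C$ is downward closed (i.e. $\langle M,s\rangle\in\mathcal C$ and $t\subseteq s$ imply $\langle M,t\rangle\in\mathcal C$).
   Context: Fix a set $\mathcal P$ of atoms. Formulas of $\mathcal L_{\Rrightarrow}$ are given by $\varphi ::= p \mid \bot \mid (\varphi\wedge\varphi)\mid(\varphi\to\varphi)\mid(\varphi\veebar\varphi)\mid(\varphi\Rrightarrow\varphi)$ with $p\in\mathcal P$, where $\veebar$ denotes inquisitive disjunction. An in-model is $M=\langle W,\Sigma,V\rangle$ where $W$ is a nonempty set of worlds, $\Sigma$ assigns to each $w\in W$ a set $\Sigma(w)$ of nonempty subsets of $W$ (neighborhoods), and $V:W\times\mathcal P\to\{0,1\}$. Support at an information state $s\subseteq W$: $M,s\models p$ iff $V(w,p)=1$ for all $w\in s$; $M,s\models\bot$ iff $s=\emptyset$; $M,s\models\varphi\wedge\psi$ iff both; $M,s\models\varphi\veebar\psi$ iff $M,s\models\varphi$ or $M,s\models\psi$;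 $M,s\models\varphi\to\psi$ iff for all $t\subseteq s$, $M,t\models\varphi$ implies $M,t\models\psi$; $M,s\models\varphi\Rrightarrow\psi$ iff for all $w\in s$ and all $t\in\Sigma(w)$, $M,t\models\varphi$ implies $M,t\models\psi$. A state-pointed in-model is a pair $\langle M,s\rangle$ with $s\subseteq W$. For a relation $R\subseteq X\times Y$, its Egli-Milner lifting $\overline R\subseteq\wp(X)\times\wp(Y)$ is: $A\overline R B$ iff every $a\in A$ has some $b\in B$ with $aRb$ and every $b\in B$ has some $a\in A$ with $aRb$. For in-models $M=\langle W,\Sigma,V\rangle$, $M'=\langle W',\Sigma',V'\rangle$, an $n$-bisimulation is a family $(Z_i)_{i\le n}$ of relations $Z_i\subseteq W\times W'$ such that whenever $wZ_iw'$: $V(w,p)=V'(w',p)$ for all $p\in\mathcal P$; if $i>0$, for each $s\in\Sigma(w)$ there is $s'\in\Sigma'(w')$ with $s\overline{Z_{i-1}}s'$; if $i>0$, for each $s'\in\Sigma'(w')$ there is $s\in\Sigma(w)$ with $s\overline{Z_{i-1}}s'$. $M,s\sim_n M',s'$ means there is an $n$-bisimulation with $s\overline{Z_n}s'$. -}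

module Defs where

open import Level using (Level; 0ℓ; Lift) renaming (suc to lsuc)
open import Data.Nat using (ℕ; zero; suc; _≤_)
open import Data.Fin using (Fin)
open import Data.Bool using (Bool; true)
open import Data.Product using (Σ; ∃; _×_; _,_)
open import Data.Sum using (_⊎_)
open import Data.Empty using (⊥)
open import Relation.Binary.PropositionalEquality using (_≡_)
open import Relation.Unary using (Pred; _⊆_; _∈_)
open import Function.Bundles using (_⇔_)

data Form (k : ℕ) : Set where
  atom : Fin k → Form k
  ⊥f   : Form k
  _∧f_ : Form k → Form k → Form k
  _→f_ : Form k → Form k → Form k
  _⩡_  : Form k → Form k → Form k
  _⇛_  : Form k → Form k → Form k

record InModel (k : ℕ) : Set₁ where
  field
    W      : Set
    w₀     : W                                  -- W is nonempty
    Nb     : W → Pred (Pred W 0ℓ) 0ℓ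
    Nb-ne  : ∀ w t → t ∈ Nb w → ∃ λ x → x ∈ t
    V      : W → Fin k → Bool

open InModel public

_,_⊨_ : ∀ {k} (M : InModel k) → Pred (W M) 0ℓ → Form k → Set₁
M , s ⊨ atom p  = ∀ w → w ∈ s → Lift (lsuc 0ℓ) (V M w p ≡ true)
M , s ⊨ ⊥f      = ∀ w → w ∈ s → Lift (lsuc 0ℓ) ⊥
M , s ⊨ (φ ∧f ψ) = (M , s ⊨ φ) × (M , s ⊨ ψ)
M , s ⊨ (φ ⩡ ψ)  = (M , s ⊨ φ) ⊎ (M , s ⊨ ψ)
M , s ⊨ (φ →f ψ) = ∀ (t : Pred (W M) 0ℓ) → t ⊆ s → M , t ⊨ φ → M , t ⊨ ψ
M , s ⊨ (φ ⇛ ψ)  = ∀ w → w ∈ s → ∀ (t : Pred (W M) 0ℓ) → t ∈ Nb M w →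
                     M , t ⊨ φ → M , t ⊨ ψ

record SPModel (k : ℕ) : Set₁ where
  constructor ⟨_,_⟩
  field
    model : InModel k
    state : Pred (W model) 0ℓ

EgliMilner : ∀ {X Y : Set} → (X → Y → Set) → Pred X 0ℓ → Pred Y 0ℓ → Set
EgliMilner R A B = (∀ a → a ∈ A → ∃ λ b → b ∈ B × R a b)
                 × (∀ b → b ∈ B → ∃ λ a → a ∈ A × R a b)

-- (Z_i)_{i ≤ n} is an n-bisimulation (the relations Z_i for i > n are unconstrained).
IsNBisim : ∀ {k} (n : ℕ) (M M' : InModel k) → (ℕ → W M → W M' → Set) → Set₁
IsNBisim n M M' Z =
  ∀ i → i ≤ n → ∀ w w' → Z i w w' →
    (∀ p → V M w p ≡ V M' w' p)
    × (∀ j → i ≡ suc j →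
         (∀ t → t ∈ Nb M w → ∃ λ t' → t' ∈ Nb M' w' × EgliMilner (Z j) t t')
       × (∀ t' → t' ∈ Nb M' w' → ∃ λ t → t ∈ Nb M w × EgliMilner (Z j) t t'))

_∼[_]_ : ∀ {k} → SPModel k → ℕ → SPModel k → Set₁
⟨ M , s ⟩ ∼[ n ] ⟨ M' , s' ⟩ =
  Σ (ℕ → W M → W M' → Set) λ Z → IsNBisim n M M' Z × EgliMilner (Z n) s s'

Class : ℕ → Set₂
Class k = SPModel k → Set₁

Definable : ∀ {k} → Class k → Set₁
Definable {k} C = ∃ λ (φ : Form k) →
  ∀ (M : InModel k) (s : Pred (W M) 0ℓ) → C ⟨ M , s ⟩ ⇔ (M , s ⊨ φ)

ClosedUnderBisim : ∀ {k} → ℕ → Class k → Set₁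
ClosedUnderBisim n C = ∀ P P' → C P → P ∼[ n ] P' → C P'

NonemptyClass : ∀ {k} → Class k → Set₁
NonemptyClass {k} C = ∃ λ (P : SPModel k) → C P

DownwardClosed : ∀ {k} → Class k → Set₁
DownwardClosed C = ∀ (M : InModel _) (s t : Pred (W M) 0ℓ) → C ⟨ M , s ⟩ → t ⊆ s → C ⟨ M , t ⟩

{-# OPTIONS --safe #-}
-- Forward: support is persistent, the empty state supports every formula, and
-- support of a formula of modal depth d is invariant under d-bisimilarity.
-- Backward: with finitely many atoms there are finitely many n-types of worlds,
-- each characterised on singletons by a formula.  If every type realised in s is
-- realised in a member ⟨M₀, s₀⟩ of C, then s is n-bisimilar to the substate of s₀
-- of worlds whose type occurs in s, so ⟨M, s⟩ ∈ C by downward closure and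
-- bisimulation closure.  Hence C is defined by the disjunction, over the type
-- sets realised by members of C, of "every world has its type in this set";
-- non-emptiness of C puts the empty state, which supports ⊥, into C.  Excluded
-- middle makes realisation of type sets decidable, so types can be coded by numbers.
module Submission where

open import Defs
open import Level using (0ℓ; Lift; lift; lower) renaming (suc to lsuc)
open import Data.Nat using (ℕ; zero; suc; _≤_; _⊔_; _^_; _*_; s≤s)
open import Data.Nat.Properties using (≤-refl; <⇒≤; m⊔n≤o⇒m≤o; m⊔n≤o⇒n≤o)
open import Data.Fin using (Fin; zero; suc; combine; remQuot; funToFin; finToFun; _≟_)
open import Data.Fin.Properties
  using (2↔Bool; finToFun-funToFin; funToFin-finToFin; remQuot-combine; combine-remQuot;
         combine-injectiveˡ; combine-injectiveʳ; ¬∀⟶∃¬)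
open import Data.Bool using (Bool; true; false; if_then_else_)
open import Data.Bool.Properties using (¬-not; not-¬) renaming (_≟_ to _≟ᵇ_)
open import Data.Product using (∃; _×_; _,_; proj₁; proj₂; map₂; swap)
open import Data.Sum using (_⊎_; inj₁; inj₂)
open import Data.Empty using (⊥-elim)
open import Data.Unit using (⊤; tt)
open import Function using (_∘_; flip)
open import Function.Bundles using (_⇔_; mk⇔; Equivalence; Inverse)
open import Relation.Binary.PropositionalEquality
  using (_≡_; _≢_; _≗_; refl; sym; trans; cong; cong₂; subst)
open import Relation.Nullary using (Dec; yes; no; ¬_; does; contradiction)
open import Relation.Nullary.Decidable using (dec-true; dec-false; decidable-stable)
open import Relation.Unary using (Pred; _⊆_; _∈_; ∅; ｛_｝; Empty; Satisfiable)
open import Axiom.ExcludedMiddle using (ExcludedMiddle)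

open Equivalence using (to; from)

private variable
  k m : ℕ

⊤f : Form k
⊤f = ⊥f →f ⊥f

¬f : Form k → Form k
¬f φ = φ →f ⊥f

⋀ : (Fin m → Form k) → Form k
⋀ {zero}  f = ⊤f
⋀ {suc m} f = f zero ∧f ⋀ (f ∘ suc)

⋁ : (Fin m → Form k) → Form k
⋁ {zero}  f = ⊥f
⋁ {suc m} f = f zero ⩡ ⋁ (f ∘ suc)

guard : Bool → Form k → Form k
guard true  φ = φ
guard false φ = ⊥f

lit : Bool → Form k → Form k
lit true  φ = φ
lit false φ = ¬f φ

profile : (Fin m → Form k) → (Fin m → Bool) → Form k
profile φ b = ⋀ λ x → lit (b x) (φ x)

depth : Form k → ℕ
depth (atom _) = 0
depth ⊥f       = 0
depth (φ ∧f ψ) = depth φ ⊔ depth ψ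
depth (φ →f ψ) = depth φ ⊔ depth ψ
depth (φ ⩡ ψ)  = depth φ ⊔ depth ψ
depth (φ ⇛ ψ)  = suc (depth φ ⊔ depth ψ)

module _ (M : InModel k) where

  persistence : ∀ φ {s t : Pred (W M) 0ℓ} → t ⊆ s → M , s ⊨ φ → M , t ⊨ φ
  persistence (atom p) t⊆s h w w∈t = h w (t⊆s w∈t)
  persistence ⊥f       t⊆s h w w∈t = h w (t⊆s w∈t)
  persistence (φ ∧f ψ) t⊆s (hφ , hψ) = persistence φ t⊆s hφ , persistence ψ t⊆s hψ
  persistence (φ →f ψ) t⊆s h u u⊆t = h u (t⊆s ∘ u⊆t)
  persistence (φ ⩡ ψ)  t⊆s (inj₁ h) = inj₁ (persistence φ t⊆s h)
  persistence (φ ⩡ ψ)  t⊆s (inj₂ h) = inj₂ (persistence ψ t⊆s h)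
  persistence (φ ⇛ ψ)  t⊆s h w w∈t = h w (t⊆s w∈t)

  empty-support : ∀ φ {s : Pred (W M) 0ℓ} → Empty s → M , s ⊨ φ
  empty-support (atom p) s-empty w w∈s = ⊥-elim (s-empty w w∈s)
  empty-support ⊥f       s-empty w w∈s = ⊥-elim (s-empty w w∈s)
  empty-support (φ ∧f ψ) s-empty = empty-support φ s-empty , empty-support ψ s-empty
  empty-support (φ →f ψ) s-empty t t⊆s _ = empty-support ψ (λ w w∈t → s-empty w (t⊆s w∈t))
  empty-support (φ ⩡ ψ)  s-empty = inj₁ (empty-support φ s-empty)
  empty-support (φ ⇛ ψ)  s-empty w w∈s = ⊥-elim (s-empty w w∈s)

  ⊨⊤f : ∀ {s} → M , s ⊨ ⊤f
  ⊨⊤f _ _ h = h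

  ⊨⊥f⇒Empty : ∀ {s} → M , s ⊨ ⊥f → Empty s
  ⊨⊥f⇒Empty h w w∈s = lower (h w w∈s)

  ⊨¬f⇔ : ∀ φ {s} → M , s ⊨ ¬f φ ⇔ (∀ w → w ∈ s → ¬ M , ｛ w ｝ ⊨ φ)
  ⊨¬f⇔ φ = mk⇔
    (λ h w w∈s hφ → lower (h ｛ w ｝ (λ { refl → w∈s }) hφ w refl))
    (λ h t t⊆s hφ w w∈t → ⊥-elim (h w (t⊆s w∈t) (persistence φ (λ { refl → w∈t }) hφ)))

  ⊨¬f-singleton⇔ : ∀ φ {w} → M , ｛ w ｝ ⊨ ¬f φ ⇔ (¬ M , ｛ w ｝ ⊨ φ)
  ⊨¬f-singleton⇔ φ {w} =
    mk⇔ (λ h → ⊨¬f⇔ φ .to h w refl) (λ h → ⊨¬f⇔ φ .from λ { _ refl → h })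

  ⊨atom-singleton⇔ : ∀ p {w} → M , ｛ w ｝ ⊨ atom p ⇔ V M w p ≡ true
  ⊨atom-singleton⇔ p {w} = mk⇔ (λ h → lower (h w refl)) (λ { e _ refl → lift e })

  ⊨⋀⇔ : (f : Fin m → Form k) → ∀ {s} → M , s ⊨ ⋀ f ⇔ (∀ x → M , s ⊨ f x)
  ⊨⋀⇔ {zero}  f = mk⇔ (λ _ ()) (λ _ → ⊨⊤f)
  ⊨⋀⇔ {suc m} f = mk⇔
    (λ { (h₀ , _) zero → h₀ ; (_ , h) (suc x) → ⊨⋀⇔ (f ∘ suc) .to h x })
    (λ h → h zero , ⊨⋀⇔ (f ∘ suc) .from (h ∘ suc))

  ⋁-intro : (f : Fin m → Form k) → ∀ {s} x → M , s ⊨ f x → M , s ⊨ ⋁ f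
  ⋁-intro f zero    h = inj₁ h
  ⋁-intro f (suc x) h = inj₂ (⋁-intro (f ∘ suc) x h)

  ⋁-elim : (f : Fin m → Form k) → ∀ {s} → M , s ⊨ ⋁ f → (∃ λ x → M , s ⊨ f x) ⊎ Empty s
  ⋁-elim {zero}  f h        = inj₂ (⊨⊥f⇒Empty h)
  ⋁-elim {suc m} f (inj₁ h) = inj₁ (zero , h)
  ⋁-elim {suc m} f (inj₂ h) with ⋁-elim (f ∘ suc) h
  ... | inj₁ (x , hx) = inj₁ (suc x , hx)
  ... | inj₂ s-empty  = inj₂ s-empty

  ⊨guard-intro : ∀ {b φ s} → b ≡ true → M , s ⊨ φ → M , s ⊨ guard b φ
  ⊨guard-intro refl h = h

  ⊨guard-elim : ∀ b {φ s} → Satisfiable s → M , s ⊨ guard b φ → b ≡ true × M , s ⊨ φ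
  ⊨guard-elim true  _         h = refl , h
  ⊨guard-elim false (w , w∈s) h = ⊥-elim (⊨⊥f⇒Empty h w w∈s)

  ⊨lit-singleton⇔ : ∀ {φ w a} b → (M , ｛ w ｝ ⊨ φ ⇔ a ≡ true) →
                     (M , ｛ w ｝ ⊨ lit b φ ⇔ a ≡ b)
  ⊨lit-singleton⇔ true  φ⇔ = φ⇔
  ⊨lit-singleton⇔ {φ} false φ⇔ = mk⇔
    (λ h → ¬-not λ a≡true → ⊨¬f-singleton⇔ φ .to h (φ⇔ .from a≡true))
    (λ a≡false → ⊨¬f-singleton⇔ φ .from λ hφ → not-¬ a≡false (φ⇔ .to hφ))

  ⊨profile-singleton⇔ : (φ : Fin m → Form k) → ∀ {w a} →
                         (∀ x → M , ｛ w ｝ ⊨ φ x ⇔ a x ≡ true) →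
                         ∀ {b} → M , ｛ w ｝ ⊨ profile φ b ⇔ a ≗ b
  ⊨profile-singleton⇔ φ φ⇔ {b} = mk⇔
    (λ h x → ⊨lit-singleton⇔ (b x) (φ⇔ x) .to (⊨⋀⇔ _ .to h x))
    (λ a≗b → ⊨⋀⇔ _ .from λ x → ⊨lit-singleton⇔ (b x) (φ⇔ x) .from (a≗b x))

EgliMilner-restrict : ∀ {X Y : Set} {R : X → Y → Set} {A : Pred X 0ℓ} {B : Pred Y 0ℓ} →
                      (∀ b → b ∈ B → ∃ λ a → a ∈ A × R a b) →
                      ∃ λ (A′ : Pred X 0ℓ) → A′ ⊆ A × EgliMilner R A′ B
EgliMilner-restrict {R = R} {A} {B} covered =
  A′ , proj₁ ,
  (λ { a (_ , b , b∈B , aRb) → b , b∈B , aRb }) ,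
  (λ b b∈B → let (a , a∈A , aRb) = covered b b∈B in a , (a∈A , b , b∈B , aRb) , aRb)
  where
  A′ : Pred _ 0ℓ
  A′ a = a ∈ A × ∃ λ b → b ∈ B × R a b

IsNBisim-converse : ∀ {n} (M M′ : InModel k) {Z} →
                    IsNBisim n M M′ Z → IsNBisim n M′ M (λ i → flip (Z i))
IsNBisim-converse M M′ bis i i≤n w′ w z =
  let (same-val , step) = bis i i≤n w w′ z in
  (λ p → sym (same-val p)) ,
  λ j i≡1+j → let (forth , back) = step j i≡1+j in
    (λ t′ t′∈ → map₂ (map₂ swap) (back t′ t′∈)) ,
    (λ t t∈ → map₂ (map₂ swap) (forth t t∈))

-- The antecedents of →f and ⇛ are transported backwards, along the converse
-- bisimulation.
bisim-invariance : ∀ φ {n i} (M M′ : InModel k) {Z} → IsNBisim n M M′ Z →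
                   i ≤ n → depth φ ≤ i →
                   ∀ {s s′} → EgliMilner (Z i) s s′ → M , s ⊨ φ → M′ , s′ ⊨ φ
bisim-invariance (atom p) M M′ bis i≤n _ (_ , back) h w′ w′∈s′ =
  let (w , w∈s , z) = back w′ w′∈s′ in
  lift (trans (sym (proj₁ (bis _ i≤n w w′ z) p)) (lower (h w w∈s)))
bisim-invariance ⊥f M M′ bis i≤n _ (_ , back) h w′ w′∈s′ =
  let (w , w∈s , _) = back w′ w′∈s′ in h w w∈s
bisim-invariance (φ ∧f ψ) M M′ bis i≤n d em (hφ , hψ) =
  bisim-invariance φ M M′ bis i≤n (m⊔n≤o⇒m≤o _ _ d) em hφ ,
  bisim-invariance ψ M M′ bis i≤n (m⊔n≤o⇒n≤o _ _ d) em hψ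
bisim-invariance (φ ⩡ ψ) M M′ bis i≤n d em (inj₁ h) =
  inj₁ (bisim-invariance φ M M′ bis i≤n (m⊔n≤o⇒m≤o _ _ d) em h)
bisim-invariance (φ ⩡ ψ) M M′ bis i≤n d em (inj₂ h) =
  inj₂ (bisim-invariance ψ M M′ bis i≤n (m⊔n≤o⇒n≤o _ _ d) em h)
bisim-invariance (φ →f ψ) M M′ bis i≤n d (_ , back) h t′ t′⊆s′ hφ =
  let (t , t⊆s , em) = EgliMilner-restrict λ w′ w′∈t′ → back w′ (t′⊆s′ w′∈t′) in
  bisim-invariance ψ M M′ bis i≤n (m⊔n≤o⇒n≤o _ _ d) em
    (h t t⊆s (bisim-invariance φ M′ M (IsNBisim-converse M M′ bis) i≤n (m⊔n≤o⇒m≤o _ _ d)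
                                 (swap em) hφ))
bisim-invariance (φ ⇛ ψ) M M′ bis i≤n (s≤s d) (_ , back) h w′ w′∈s′ t′ t′∈ hφ =
  let (w , w∈s , z) = back w′ w′∈s′
      (t , t∈ , em) = proj₂ (proj₂ (bis _ i≤n w w′ z) _ refl) t′ t′∈
  in bisim-invariance ψ M M′ bis (<⇒≤ i≤n) (m⊔n≤o⇒n≤o _ _ d) em
       (h w w∈s t t∈ (bisim-invariance φ M′ M (IsNBisim-converse M M′ bis) (<⇒≤ i≤n)
                                        (m⊔n≤o⇒m≤o _ _ d) (swap em) hφ))

definable⇒conditions : (C : Class k) → Definable C →
                       (∃ λ n → ClosedUnderBisim n C) × NonemptyClass C × DownwardClosed C
definable⇒conditions {k} C (φ , C⇔φ) =
  (depth φ , closed) ,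
  (⟨ trivial , ∅ ⟩ , C⇔φ trivial ∅ .from (empty-support trivial φ λ _ ())) ,
  downward
  where
  closed : ClosedUnderBisim (depth φ) C
  closed ⟨ M , s ⟩ ⟨ M′ , s′ ⟩ Cs (Z , bis , em) =
    C⇔φ M′ s′ .from (bisim-invariance φ M M′ bis ≤-refl ≤-refl em (C⇔φ M s .to Cs))

  downward : DownwardClosed C
  downward M s t Cs t⊆s = C⇔φ M t .from (persistence M φ t⊆s (C⇔φ M s .to Cs))

  trivial : InModel k
  trivial = record { W = ⊤ ; w₀ = tt ; Nb = λ _ → ∅ ; Nb-ne = λ _ _ () ; V = λ _ _ → true }

funToFin-cong : ∀ {n} {f g : Fin m → Fin n} → f ≗ g → funToFin f ≡ funToFin g
funToFin-cong {zero}  _   = refl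
funToFin-cong {suc m} f≗g = cong₂ combine (f≗g zero) (funToFin-cong (f≗g ∘ suc))

⌜_⌝ : (Fin m → Bool) → Fin (2 ^ m)
⌜_⌝ {m} S = funToFin {m} {2} (Inverse.from 2↔Bool ∘ S)

⌞_⌟ : Fin (2 ^ m) → Fin m → Bool
⌞_⌟ {m} c = Inverse.to 2↔Bool ∘ finToFun {2} {m} c

⌞⌜_⌝⌟ : (S : Fin m → Bool) → ⌞ ⌜ S ⌝ ⌟ ≗ S
⌞⌜ S ⌝⌟ x = trans (cong (Inverse.to 2↔Bool) (finToFun-funToFin _ x))
                  (Inverse.strictlyInverseˡ 2↔Bool (S x))

⌜⌝≡⇔ : ∀ {S : Fin m → Bool} {c} → ⌜ S ⌝ ≡ c ⇔ S ≗ ⌞ c ⌟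
⌜⌝≡⇔ {m} {S} {c} = mk⇔
  (λ { refl x → sym (⌞⌜ S ⌝⌟ x) })
  (λ S≗c → trans (funToFin-cong λ x → trans (cong (Inverse.from 2↔Bool) (S≗c x))
                                             (Inverse.strictlyInverseʳ 2↔Bool (finToFun {2} {m} c x)))
                 (funToFin-finToFin {m} {2} c))

⌜⌝-injective : ∀ {S S′ : Fin m → Bool} → ⌜ S ⌝ ≡ ⌜ S′ ⌝ → S ≗ S′
⌜⌝-injective {S′ = S′} eq x = trans (⌜⌝≡⇔ .to eq x) (⌞⌜ S′ ⌝⌟ x)

combine≡⇔ : ∀ n {a : Fin m} {b : Fin n} {x : Fin (m * n)} →
            combine a b ≡ x ⇔ (a ≡ proj₁ (remQuot {m} n x) × b ≡ proj₂ (remQuot {m} n x))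
combine≡⇔ {m} n {a} {b} = mk⇔
  (λ { refl → let split = sym (remQuot-combine {m} {n} a b) in cong proj₁ split , cong proj₂ split })
  (λ { (refl , refl) → combine-remQuot {m} n _ })

remove : (Fin m → Bool) → Fin m → Fin m → Bool
remove S x y = if does (x ≟ y) then false else S y

remove-self : ∀ (S : Fin m → Bool) x → remove S x x ≡ false
remove-self S x rewrite dec-true (x ≟ x) refl = refl

remove-other : ∀ (S : Fin m → Bool) {x y} → x ≢ y → remove S x y ≡ S y
remove-other S {x} {y} x≢y rewrite dec-false (x ≟ y) x≢y = refl

⊂-witness : (A B : Fin m → Bool) → (∀ x → A x ≡ true → B x ≡ true) → ¬ A ≗ B →
            ∃ λ x → A x ≡ false × B x ≡ true
⊂-witness A B A⊆B A≉B =
  let (x , Ax≢Bx) = ¬∀⟶∃¬ _ _ (λ x → A x ≟ᵇ B x) A≉B in x , witness x Ax≢Bx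
  where
  witness : ∀ x → A x ≢ B x → A x ≡ false × B x ≡ true
  witness x Ax≢Bx with A x in Ax | B x in Bx
  ... | false | true  = refl , refl
  ... | false | false = contradiction refl Ax≢Bx
  ... | true  | true  = contradiction refl Ax≢Bx
  ... | true  | false = contradiction (trans (sym (A⊆B x Ax)) Bx) λ ()

does⇔ : ∀ {a} {P : Set a} (P? : Dec P) → does P? ≡ true ⇔ P
does⇔ (yes p) = mk⇔ (λ _ → p) (λ _ → refl)
does⇔ (no ¬p) = mk⇔ (λ ()) (λ p → contradiction p ¬p)

-- The i-types are coded by numbers below typeCount k i: a subset of Fin m is
-- coded in Fin (2 ^ m), and an (i+1)-type pairs the code of the valuation with
-- the code of the set of i-type sets realised by the neighbourhoods.
typeCount : ℕ → ℕ → ℕ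
typeCount k zero    = 2 ^ k
typeCount k (suc i) = 2 ^ k * 2 ^ 2 ^ typeCount k i

within : (Fin m → Form k) → (Fin m → Bool) → Form k
within χ S = ⋀ λ x → if S x then ⊤f else ¬f (χ x)

dropsOne : (Fin m → Form k) → (Fin m → Bool) → Form k
dropsOne χ S = ⋁ λ x → guard (S x) (within χ (remove S x))

noneRealises : (Fin m → Form k) → (Fin m → Bool) → Form k
noneRealises χ S = within χ S ⇛ dropsOne χ S

realises : (Fin m → Form k) → Fin (2 ^ m) → Form k
realises χ c = ¬f (noneRealises χ ⌞ c ⌟)

char : (i : ℕ) → Fin (typeCount k i) → Form k
char zero x = profile atom ⌞ x ⌟
char {k} (suc i) x =
  profile atom ⌞ proj₁ (remQuot {2 ^ k} (2 ^ 2 ^ typeCount k i) x) ⌟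
  ∧f profile (realises (char i)) ⌞ proj₂ (remQuot {2 ^ k} (2 ^ 2 ^ typeCount k i) x) ⌟

module Realisation (lem : ExcludedMiddle (lsuc 0ℓ)) where

  realised : {X : Set} → (X → Fin m) → Pred X 0ℓ → Fin m → Bool
  realised τ t x = does (lem {Lift _ (∃ λ v → v ∈ t × τ v ≡ x)})

  realised⇔ : ∀ {X : Set} (τ : X → Fin m) {t x} →
              realised τ t x ≡ true ⇔ (∃ λ v → v ∈ t × τ v ≡ x)
  realised⇔ τ = mk⇔ (lower ∘ does⇔ lem .to) (does⇔ lem .from ∘ lift)

  realised-intro : ∀ {X : Set} (τ : X → Fin m) {t v} → v ∈ t → realised τ t (τ v) ≡ true
  realised-intro τ v∈t = realised⇔ τ .from (_ , v∈t , refl)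

  realised-false⇒≢ : ∀ {X : Set} (τ : X → Fin m) {t x v} → realised τ t x ≡ false → v ∈ t → x ≢ τ v
  realised-false⇒≢ τ x∉t v∈t refl = contradiction (trans (sym x∉t) (realised-intro τ v∈t)) λ ()

  realised-≗⇒EgliMilner : ∀ {X Y : Set} (τ : X → Fin m) (τ′ : Y → Fin m) {t t′} →
                          realised τ t ≗ realised τ′ t′ → EgliMilner (λ w w′ → τ w ≡ τ′ w′) t t′
  realised-≗⇒EgliMilner τ τ′ t≗t′ =
    (λ w w∈t →
      let (w′ , w′∈t′ , e) = realised⇔ τ′ .to (trans (sym (t≗t′ _)) (realised-intro τ w∈t))
      in w′ , w′∈t′ , sym e) ,
    (λ w′ w′∈t′ → realised⇔ τ .to (trans (t≗t′ _) (realised-intro τ′ w′∈t′)))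

  nbRealised : (M : InModel k) → (W M → Fin m) → W M → Fin (2 ^ m) → Bool
  nbRealised M τ w c = does (lem {∃ λ t → t ∈ Nb M w × realised τ t ≗ ⌞ c ⌟})

  nbRealised⇔ : ∀ (M : InModel k) (τ : W M → Fin m) {w c} →
                nbRealised M τ w c ≡ true ⇔ (∃ λ t → t ∈ Nb M w × realised τ t ≗ ⌞ c ⌟)
  nbRealised⇔ M τ = does⇔ lem

  nbRealised-forth : ∀ (M M′ : InModel k) (τ : W M → Fin m) (τ′ : W M′ → Fin m) {w w′ t} →
                     nbRealised M τ w ≗ nbRealised M′ τ′ w′ → t ∈ Nb M w →
                     ∃ λ t′ → t′ ∈ Nb M′ w′ × realised τ t ≗ realised τ′ t′
  nbRealised-forth M M′ τ τ′ {t = t} w≗w′ t∈ =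
    let (t′ , t′∈ , t′≗types) = nbRealised⇔ M′ τ′ .to (trans (sym (w≗w′ ⌜ types ⌝)) w-realises)
    in t′ , t′∈ , λ x → trans (sym (⌞⌜ types ⌝⌟ x)) (sym (t′≗types x))
    where
    types : Fin _ → Bool
    types = realised τ t
    w-realises : nbRealised M τ _ ⌜ types ⌝ ≡ true
    w-realises = nbRealised⇔ M τ .from (t , t∈ , sym ∘ ⌞⌜ types ⌝⌟)

  type : (M : InModel k) (i : ℕ) → W M → Fin (typeCount k i)
  type M zero    w = ⌜ V M w ⌝
  type M (suc i) w = combine ⌜ V M w ⌝ ⌜ nbRealised M (type M i) w ⌝

  SameType : (M M′ : InModel k) → ℕ → W M → W M′ → Set
  SameType M M′ i w w′ = type M i w ≡ type M′ i w′

  sameType⇒sameValuation : ∀ {M M′ : InModel k} i {w w′} → SameType M M′ i w w′ → V M w ≗ V M′ w′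
  sameType⇒sameValuation zero    eq = ⌜⌝-injective eq
  sameType⇒sameValuation {M = M} {M′} (suc i) {w} {w′} eq =
    ⌜⌝-injective (combine-injectiveˡ ⌜ V M w ⌝ _ ⌜ V M′ w′ ⌝ _ eq)

  sameType⇒sameNbRealised : ∀ {M M′ : InModel k} i {w w′} → SameType M M′ (suc i) w w′ →
                            nbRealised M (type M i) w ≗ nbRealised M′ (type M′ i) w′
  sameType⇒sameNbRealised {M = M} {M′} i {w} {w′} eq =
    ⌜⌝-injective (combine-injectiveʳ ⌜ V M w ⌝ _ ⌜ V M′ w′ ⌝ _ eq)

  sameType-isNBisim : ∀ n {M M′ : InModel k} → IsNBisim n M M′ (SameType M M′)
  sameType-isNBisim n {M} {M′} i _ w w′ eq = sameType⇒sameValuation i eq , λ { j refl →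
    (λ t t∈ →
      let (t′ , t′∈ , t≗t′) =
            nbRealised-forth M M′ (type M j) (type M′ j) (sameType⇒sameNbRealised j eq) t∈
      in t′ , t′∈ , realised-≗⇒EgliMilner _ _ t≗t′) ,
    (λ t′ t′∈ →
      let (t , t∈ , t′≗t) =
            nbRealised-forth M′ M (type M′ j) (type M j) (sym ∘ sameType⇒sameNbRealised j eq) t′∈
      in t , t∈ , realised-≗⇒EgliMilner _ _ (sym ∘ t′≗t)) }

module Characterisation (lem : ExcludedMiddle (lsuc 0ℓ)) (M : InModel k) {m}
                        (χ : Fin m → Form k) (τ : W M → Fin m)
                        (⊨χ⇔ : ∀ w x → M , ｛ w ｝ ⊨ χ x ⇔ τ w ≡ x) where
  open Realisation lem

  ⊨within⇔ : ∀ {S s} → M , s ⊨ within χ S ⇔ (∀ w → w ∈ s → S (τ w) ≡ true)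
  ⊨within⇔ {S} {s} = mk⇔ sound complete
    where
    sound : M , s ⊨ within χ S → ∀ w → w ∈ s → S (τ w) ≡ true
    sound h w w∈s with S (τ w) | ⊨⋀⇔ M _ .to h (τ w)
    ... | true  | _    = refl
    ... | false | h-τw = ⊥-elim (⊨¬f⇔ M (χ (τ w)) .to h-τw w w∈s (⊨χ⇔ w (τ w) .from refl))

    complete : (∀ w → w ∈ s → S (τ w) ≡ true) → M , s ⊨ within χ S
    complete h = ⊨⋀⇔ M _ .from conjunct
      where
      conjunct : ∀ x → M , s ⊨ (if S x then ⊤f else ¬f (χ x))
      conjunct x with S x in Sx
      ... | true  = ⊨⊤f M
      ... | false = ⊨¬f⇔ M (χ x) .from λ w w∈s w⊨χx →
        contradiction (trans (sym (h w w∈s)) (trans (cong S (⊨χ⇔ w x .to w⊨χx)) Sx)) λ ()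

  -- A nonempty t supporting within χ S has its types in S; dropsOne χ S then
  -- says that they form a proper subset of S.
  dropsOne-sound : ∀ {S t} → Satisfiable t → M , t ⊨ dropsOne χ S → ¬ realised τ t ≗ S
  dropsOne-sound {S} t≠∅ h t≗S with ⋁-elim M _ h
  ... | inj₂ t-empty  = t-empty _ (proj₂ t≠∅)
  ... | inj₁ (x , hx) =
    let (Sx , t⊨within) = ⊨guard-elim M (S x) t≠∅ hx
        (v , v∈t , τv≡x) = realised⇔ τ .to (trans (t≗S x) Sx)
        x∈S-x = subst (λ y → remove S x y ≡ true) τv≡x (⊨within⇔ .to t⊨within v v∈t)
    in contradiction (trans (sym (remove-self S x)) x∈S-x) λ ()

  dropsOne-complete : ∀ {S t} → (∀ w → w ∈ t → S (τ w) ≡ true) → ¬ realised τ t ≗ S →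
                      M , t ⊨ dropsOne χ S
  dropsOne-complete {S} {t} t⊆S t≉S =
    let (x , x∉t , x∈S) = ⊂-witness (realised τ t) S realised⊆S t≉S
    in ⋁-intro M _ x (⊨guard-intro M x∈S (⊨within⇔ .from λ v v∈t →
         trans (remove-other S (realised-false⇒≢ τ x∉t v∈t)) (t⊆S v v∈t)))
    where
    realised⊆S : ∀ x → realised τ t x ≡ true → S x ≡ true
    realised⊆S x x∈t =
      let (v , v∈t , τv≡x) = realised⇔ τ .to x∈t in subst (λ y → S y ≡ true) τv≡x (t⊆S v v∈t)

  ⊨noneRealises⇔ : ∀ {w S} →
                   M , ｛ w ｝ ⊨ noneRealises χ S ⇔ (∀ t → t ∈ Nb M w → ¬ realised τ t ≗ S)
  ⊨noneRealises⇔ {w} = mk⇔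
    (λ h t t∈ t≗S → dropsOne-sound (Nb-ne M w t t∈)
      (h w refl t t∈ (⊨within⇔ .from λ v v∈t → trans (sym (t≗S (τ v))) (realised-intro τ v∈t))) t≗S)
    (λ { h _ refl t t∈ t⊨within → dropsOne-complete (⊨within⇔ .to t⊨within) (h t t∈) })

  ⊨realises⇔ : ∀ {w c} → M , ｛ w ｝ ⊨ realises χ c ⇔ nbRealised M τ w c ≡ true
  ⊨realises⇔ {w} {c} = mk⇔
    (λ h → nbRealised⇔ M τ .from (decidable-stable lem λ ¬∃ →
       ⊨¬f-singleton⇔ M (noneRealises χ ⌞ c ⌟) .to h
         (⊨noneRealises⇔ .from λ t t∈ t≗c → ¬∃ (t , t∈ , t≗c))))
    (λ w∈ → ⊨¬f-singleton⇔ M (noneRealises χ ⌞ c ⌟) .from λ none →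
       let (t , t∈ , t≗c) = nbRealised⇔ M τ .to w∈ in ⊨noneRealises⇔ .to none t t∈ t≗c)

module _ (lem : ExcludedMiddle (lsuc 0ℓ)) (M : InModel k) where
  open Realisation lem

  ⊨char⇔ : ∀ i w x → M , ｛ w ｝ ⊨ char i x ⇔ type M i w ≡ x
  ⊨char⇔ zero w x = mk⇔ (⌜⌝≡⇔ .from ∘ ⊨valuation .to) (⊨valuation .from ∘ ⌜⌝≡⇔ .to)
    where
    ⊨valuation : M , ｛ w ｝ ⊨ profile atom ⌞ x ⌟ ⇔ V M w ≗ ⌞ x ⌟
    ⊨valuation = ⊨profile-singleton⇔ M atom λ p → ⊨atom-singleton⇔ M p
  ⊨char⇔ (suc i) w x = mk⇔
    (λ (h₁ , h₂) → combine≡⇔ _ .from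
                     (⌜⌝≡⇔ .from (⊨valuation .to h₁) , ⌜⌝≡⇔ .from (⊨nbRealised .to h₂)))
    (λ eq → let (e₁ , e₂) = combine≡⇔ _ .to eq
            in ⊨valuation .from (⌜⌝≡⇔ .to e₁) , ⊨nbRealised .from (⌜⌝≡⇔ .to e₂))
    where
    open Characterisation lem M (char i) (type M i) (⊨char⇔ i)
    parts : Fin (2 ^ k) × Fin (2 ^ 2 ^ typeCount k i)
    parts = remQuot (2 ^ 2 ^ typeCount k i) x
    ⊨valuation : M , ｛ w ｝ ⊨ profile atom ⌞ proj₁ parts ⌟ ⇔ V M w ≗ ⌞ proj₁ parts ⌟
    ⊨valuation = ⊨profile-singleton⇔ M atom λ p → ⊨atom-singleton⇔ M p
    ⊨nbRealised : M , ｛ w ｝ ⊨ profile (realises (char i)) ⌞ proj₂ parts ⌟ ⇔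
                  nbRealised M (type M i) w ≗ ⌞ proj₂ parts ⌟
    ⊨nbRealised = ⊨profile-singleton⇔ M (realises (char i)) λ c → ⊨realises⇔

module Definability (lem : ExcludedMiddle (lsuc 0ℓ)) {C : Class k} {n : ℕ}
                    (closed : ClosedUnderBisim n C) (nonempty : NonemptyClass C)
                    (downward : DownwardClosed C) where
  open Realisation lem

  RealisedInC : Fin (2 ^ typeCount k n) → Set₁
  RealisedInC c =
    ∃ λ (P : SPModel k) → C P × realised (type (SPModel.model P) n) (SPModel.state P) ≗ ⌞ c ⌟

  definingFormula : Form k
  definingFormula = ⋁ λ c → guard (does (lem {RealisedInC c})) (within (char n) ⌞ c ⌟)

  typesCovered⇒C : ∀ {M₀ s₀ M s} → C ⟨ M₀ , s₀ ⟩ →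
                   (∀ w → w ∈ s → ∃ λ v → v ∈ s₀ × SameType M₀ M n v w) → C ⟨ M , s ⟩
  typesCovered⇒C {M₀} {s₀} C₀ covered =
    let (t , t⊆s₀ , em) = EgliMilner-restrict covered
    in closed _ _ (downward M₀ s₀ t C₀ t⊆s₀) (SameType M₀ _ , sameType-isNBisim n , em)

  Empty⇒C : ∀ {M s} → Empty s → C ⟨ M , s ⟩
  Empty⇒C s-empty = typesCovered⇒C (proj₂ nonempty) λ w w∈s → ⊥-elim (s-empty w w∈s)

  definingFormula-complete : ∀ M s → C ⟨ M , s ⟩ → M , s ⊨ definingFormula
  definingFormula-complete M s Cs =
    ⋁-intro M _ ⌜ types ⌝ (⊨guard-intro M (dec-true lem (⟨ M , s ⟩ , Cs , sym ∘ ⌞⌜ types ⌝⌟))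
      (⊨within⇔ .from λ w w∈s → trans (⌞⌜ types ⌝⌟ (type M n w)) (realised-intro (type M n) w∈s)))
    where
    open Characterisation lem M (char n) (type M n) (⊨char⇔ lem M n)
    types : Fin (typeCount k n) → Bool
    types = realised (type M n) s

  definingFormula-sound : ∀ M s → M , s ⊨ definingFormula → C ⟨ M , s ⟩
  definingFormula-sound M s h with ⋁-elim M _ h
  ... | inj₂ s-empty = Empty⇒C s-empty
  ... | inj₁ (c , hc) with lem {RealisedInC c}
  ...   | no _ = Empty⇒C (⊨⊥f⇒Empty M hc)
  ...   | yes (⟨ M₀ , s₀ ⟩ , C₀ , s₀≗c) = typesCovered⇒C C₀ λ w w∈s →
    realised⇔ (type M₀ n) .to (trans (s₀≗c (type M n w)) (⊨within⇔ .to hc w w∈s))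
    where open Characterisation lem M (char n) (type M n) (⊨char⇔ lem M n)

conditions⇒definable : ExcludedMiddle (lsuc 0ℓ) → (C : Class k) →
                       (∃ λ n → ClosedUnderBisim n C) × NonemptyClass C × DownwardClosed C →
                       Definable C
conditions⇒definable lem C ((n , closed) , nonempty , downward) =
  definingFormula , λ M s → mk⇔ (definingFormula-complete M s) (definingFormula-sound M s)
  where open Definability lem closed nonempty downward

theorem5p15 : ExcludedMiddle (lsuc 0ℓ) → (k : ℕ) → (C : Class k) →
    Definable C ⇔ ((∃ λ (n : ℕ) → ClosedUnderBisim n C) × NonemptyClass C × DownwardClosed C)
theorem5p15 lem k C = mk⇔ (definable⇒conditions C) (conditions⇒definable lem C)
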